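{- Let $(M,\exists,\Upsilon)$ be a ubiquity monadic algebra. Then every monadic ideal of $M$ is a ubiquity monadic ideal, i.e. if $I\subseteq M$ is a Boolean ideal with $\exists p\in I$ for all $p\in I$, then also $\Upsilon p\in I$ for all $p\in I$.
   Context: A monadic algebra is a Boolean algebra $M$ (operations $\wedge,\vee,{}'$, constants $0,1$, order $\le$) together with a map $\exists:M\to M$ such that $\exists 0=0$, $p\le\exists p$, and $\exists(p\wedge\exists q)=\exists p\wedge\exists q$ for all $p,q$. Write $\forall p:=(\exists p')'$. A ubiquity monadic algebra is a monadic algebra with a map $\Upsilon:M\to M$ such that for all $p,q\in M$: (i) $\Upsilon p\wedge\Upsilon q\le\Upsilon(p\wedge q)$; (ii) $\Upsilon p\le\Upsilon(p\vee q)$; (iii) $\forall p\le\Upsilon p\le\exists p$. A monadic ideal is a Boolean ideal closed under $\exists$; a ubiquity monadic ideal is a monadic ideal closed under $\Upsilon$. -}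

module Defs where

open import Level using (Level; _⊔_; suc)
open import Algebra.Lattice.Bundles using (BooleanAlgebra)
open import Relation.Unary using (Pred; _∈_)

module _ {c ℓ : Level} (B : BooleanAlgebra c ℓ) where
  open BooleanAlgebra B

  _≤ᴮ_ : Carrier → Carrier → Set ℓ
  p ≤ᴮ q = (p ∧ q) ≈ p

record MonadicAlgebra (c ℓ : Level) : Set (suc (c ⊔ ℓ)) where
  field
    boolean : BooleanAlgebra c ℓ
  open BooleanAlgebra boolean public
  _≤_ : Carrier → Carrier → Set ℓ
  _≤_ = _≤ᴮ_ boolean
  field
    ∃ : Carrier → Carrier
    ∃-cong : ∀ {p q} → p ≈ q → ∃ p ≈ ∃ q
    ∃-zero : ∃ ⊥ ≈ ⊥
    ∃-incr : ∀ p → p ≤ ∃ p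
    ∃-∧ : ∀ p q → ∃ (p ∧ ∃ q) ≈ (∃ p ∧ ∃ q)
  ∀' : Carrier → Carrier
  ∀' p = ¬ (∃ (¬ p))

record UbiquityMonadicAlgebra (c ℓ : Level) : Set (suc (c ⊔ ℓ)) where
  field
    monadic : MonadicAlgebra c ℓ
  open MonadicAlgebra monadic public
  field
    Υ : Carrier → Carrier
    Υ-cong : ∀ {p q} → p ≈ q → Υ p ≈ Υ q
    Υ-∧ : ∀ p q → (Υ p ∧ Υ q) ≤ Υ (p ∧ q)
    Υ-∨ : ∀ p q → Υ p ≤ Υ (p ∨ q)
    ∀≤Υ : ∀ p → ∀' p ≤ Υ p
    Υ≤∃ : ∀ p → Υ p ≤ ∃ p

module _ {c ℓ : Level} (B : BooleanAlgebra c ℓ) where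
  open BooleanAlgebra B

  record IsBooleanIdeal {ℓ′ : Level} (I : Pred Carrier ℓ′) : Set (c ⊔ ℓ ⊔ ℓ′) where
    field
      contains-⊥ : ⊥ ∈ I
      ∨-closed : ∀ {p q} → p ∈ I → q ∈ I → (p ∨ q) ∈ I
      down-closed : ∀ {p q} → _≤ᴮ_ B p q → q ∈ I → p ∈ I

module _ {c ℓ : Level} (M : MonadicAlgebra c ℓ) where
  open MonadicAlgebra M

  record IsMonadicIdeal {ℓ′ : Level} (I : Pred Carrier ℓ′) : Set (c ⊔ ℓ ⊔ ℓ′) where
    field
      isBooleanIdeal : IsBooleanIdeal boolean I
      ∃-closed : ∀ {p} → p ∈ I → ∃ p ∈ I

module _ {c ℓ : Level} (U : UbiquityMonadicAlgebra c ℓ) where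
  open UbiquityMonadicAlgebra U

  record IsUbiquityMonadicIdeal {ℓ′ : Level} (I : Pred Carrier ℓ′) : Set (c ⊔ ℓ ⊔ ℓ′) where
    field
      isMonadicIdeal : IsMonadicIdeal monadic I
      Υ-closed : ∀ {p} → p ∈ I → Υ p ∈ I

module Submission where

open import Defs
open import Level using (Level)
open import Relation.Unary using (Pred; _∈_)
open import Algebra.Lattice.Bundles using (BooleanAlgebra)

module _ {c ℓ ℓ′ : Level} (B : BooleanAlgebra c ℓ) {I : Pred (BooleanAlgebra.Carrier B) ℓ′}
         (ideal : IsBooleanIdeal B I) where
  open BooleanAlgebra B using (Carrier)

  closed-under-dominated : (f g : Carrier → Carrier) → (∀ p → _≤ᴮ_ B (f p) (g p)) →
                           (∀ {p} → p ∈ I → g p ∈ I) → ∀ {p} → p ∈ I → f p ∈ I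
  closed-under-dominated f g f≤g g-closed p∈I =
    IsBooleanIdeal.down-closed ideal (f≤g _) (g-closed p∈I)

mainTheorem11 : {c ℓ ℓ′ : Level} (U : UbiquityMonadicAlgebra c ℓ)
    (I : Pred (UbiquityMonadicAlgebra.Carrier U) ℓ′) →
    IsMonadicIdeal (UbiquityMonadicAlgebra.monadic U) I →
    IsUbiquityMonadicIdeal U I
mainTheorem11 U I monadicIdeal = record
  { isMonadicIdeal = monadicIdeal
  ; Υ-closed = closed-under-dominated boolean isBooleanIdeal Υ ∃ Υ≤∃ ∃-closed
  }
  where
  open UbiquityMonadicAlgebra U
  open IsMonadicIdeal monadicIdeal
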